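{- Let $(E,\mathcal{C},r_{\mathcal{C}})$ be a semimatroid and $\bm x=\{x_e\}_{e\in E}$, $\bm y=\{y_e\}_{e\in E}$ indeterminates. Then \[ Z(\mathcal{C};\lambda\xi,\bm x\bm y)=\sum_{T\in\mathcal{C}}\xi^{ -r_\mathcal{C}(T)}(-\bm y)^TZ(\mathcal{C}|T;\lambda,-\bm x)Z(\mathcal{C}/T;\xi,\bm y). \] In particular, \[ Z(\mathcal{C};\lambda,\bm y)=\sum_{T\in\mathcal{C}}(-\bm y)^TZ(\mathcal{C}|T;\lambda,-1)Z(\mathcal{C}/T;1,\bm y). \]
   Context: A semimatroid is a triple $(E,\mathcal{C},r_{\mathcal{C}})$ where $E$ is a finite set, $\mathcal{C}$ is a nonempty simplicial complex on $E$, and $r_{\mathcal{C}}:\mathcal{C}\to\mathbb{N}$ satisfies: (SR1) $0\le r_{\mathcal{C}}(X)\le |X|$; (SR2) $X\subseteq Y$ in $\mathcal{C}$ implies $r_{\mathcal{C}}(X)\le r_{\mathcal{C}}(Y)$; (SR3) if $X,Y,X\cup Y\in\mathcal{C}$ then $r_{\mathcal{C}}(X\cap Y)+r_{\mathcal{C}}(X\cup Y)\le r_{\mathcal{C}}(X)+r_{\mathcal{C}}(Y)$; (SR4) if $X,Y\in\mathcal{C}$ and $r_{\mathcal{C}}(X)=r_{\mathcal{C}}(X\cap Y)$ then $X\cup Y\in\mathcal{C}$; (SR5) if $X,Y\in\mathcal{C}$ and $r_{\mathcal{C}}(X)<r_{\mathcal{C}}(Y)$ then $X\cup\{e\}\in\mathcal{C}$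 for some $e\in Y-X$. For $T\in\mathcal{C}$: the restriction $\mathcal{C}|T$ is the semimatroid on $T$ with central sets $\{Y\subseteq T: Y\in\mathcal{C}\}$ and rank $r_{\mathcal{C}}$ restricted; the contraction $\mathcal{C}/T$ is the semimatroid on $E-T$ with central sets $\{Y\subseteq E-T: Y\cup T\in\mathcal{C}\}$ and rank $r_{\mathcal{C}/T}(Y)=r_{\mathcal{C}}(Y\cup T)-r_{\mathcal{C}}(T)$. For a semimatroid $\mathcal{D}$ on ground set $S$ and a family $\bm z=\{z_e\}$ indexed by (a superset of) $S$, $Z(\mathcal{D};\lambda,\bm z)=\sum_{A\in\mathcal{D}}\lambda^{ -r_{\mathcal{D}}(A)}\bm z^A$, with $\bm z^A=\prod_{e\in A}z_e$ (only the variables indexed by $S$ are used). Notation: $(\bm x\bm y)^A=\prod_{e\in A}x_ey_e$, $(-\bm y)^A=\prod_{e\in A}(-y_e)$, $-\bm x=\{ -x_e\}$, and the argument $-1$ (resp. $1$) means all variables are set to $-1$ (resp. $1$). -}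

module Defs where

open import Level using (Level)
open import Data.Nat using (ℕ; zero; suc; _≤_; _<_)
import Data.Nat as ℕ
open import Data.Bool using (Bool; true; false; if_then_else_)
open import Data.Fin using (Fin)
import Data.Fin
open import Data.Vec using (Vec; []; _∷_; lookup)
open import Data.List using (List; []; _∷_; map; _++_)
open import Data.Product using (Σ; _×_; ∃)
open import Data.Fin.Subset using (Subset; inside; outside; _∈_; _∉_; _⊆_; _∪_; _∩_; _─_; ∣_∣; ⁅_⁆)
open import Data.Fin.Subset.Properties using (_⊆?_)
open import Relation.Nullary using (does)
open import Relation.Binary.PropositionalEquality using (_≡_)
open import Algebra.Bundles using (CommutativeRing)

-- Semimatroids on the ground set E = Fin n.
-- Central sets are given by a Boolean-valued membership test C, the rank
-- function r is given on all subsets but only constrained on central sets.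

record IsSemimatroid (n : ℕ) (C : Subset n → Bool) (r : Subset n → ℕ) : Set where
  field
    nonempty   : ∃ λ X → C X ≡ true
    downClosed : ∀ {X Y} → C Y ≡ true → X ⊆ Y → C X ≡ true
    sr1 : ∀ {X} → C X ≡ true → r X ≤ ∣ X ∣
    sr2 : ∀ {X Y} → C X ≡ true → C Y ≡ true → X ⊆ Y → r X ≤ r Y
    sr3 : ∀ {X Y} → C X ≡ true → C Y ≡ true → C (X ∪ Y) ≡ true →
          r (X ∩ Y) ℕ.+ r (X ∪ Y) ≤ r X ℕ.+ r Y
    sr4 : ∀ {X Y} → C X ≡ true → C Y ≡ true → r X ≡ r (X ∩ Y) → C (X ∪ Y) ≡ true
    sr5 : ∀ {X Y} → C X ≡ true → C Y ≡ true → r X < r Y →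
          Σ (Fin n) λ e → e ∈ Y × e ∉ X × C (X ∪ ⁅ e ⁆) ≡ true

record Semimatroid (n : ℕ) : Set where
  field
    central : Subset n → Bool
    rank    : Subset n → ℕ
    isSemimatroid : IsSemimatroid n central rank

-- A "set system with rank" on a ground set S ⊆ Fin n: the data
-- (S, central sets, rank) of a semimatroid on S.  Restriction and
-- contraction produce such data; Z only depends on this data.

record RankedComplex (n : ℕ) : Set where
  field
    ground  : Subset n
    central : Subset n → Bool
    rank    : Subset n → ℕ

toRC : ∀ {n} → Semimatroid n → RankedComplex n
toRC {n} M = record
  { ground  = Data.Fin.Subset.⊤
  ; central = Semimatroid.central M
  ; rank    = Semimatroid.rank M }

-- restriction C|T : ground set T, central sets Y ⊆ T with Y ∈ C, same rank
restrict : ∀ {n} → Semimatroid n → Subset n → RankedComplex n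
restrict M T = record
  { ground  = T
  ; central = Semimatroid.central M
  ; rank    = Semimatroid.rank M }

-- contraction C/T : ground set E - T, central sets Y ⊆ E - T with Y ∪ T ∈ C,
-- rank r(Y ∪ T) - r(T)
contract : ∀ {n} → Semimatroid n → Subset n → RankedComplex n
contract M T = record
  { ground  = Data.Fin.Subset.⊤ ─ T
  ; central = λ Y → Semimatroid.central M (Y ∪ T)
  ; rank    = λ Y → Semimatroid.rank M (Y ∪ T) ℕ.∸ Semimatroid.rank M T }

subsets : (n : ℕ) → List (Subset n)
subsets zero    = [] ∷ []
subsets (suc n) = map (outside ∷_) (subsets n) ++ map (inside ∷_) (subsets n)

-- The generating function is a Laurent
-- polynomial; we evaluate it in an arbitrary commutative ring R at
-- invertible values of λ (an identity of Laurent polynomials in the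
-- indeterminates holds iff it holds for all such evaluations).

module Eval {c ℓ : Level} (R : CommutativeRing c ℓ) where
  open CommutativeRing R

  record Unit : Set (Level._⊔_ c ℓ) where
    field
      val : Carrier
      inv : Carrier
      inv-r : val * inv ≈ 1#

  oneU : Unit
  oneU = record { val = 1# ; inv = 1# ; inv-r = *-identityˡ 1# }

  _·U_ : Unit → Unit → Unit
  u ·U v = record
    { val = Unit.val u * Unit.val v
    ; inv = Unit.inv u * Unit.inv v
    ; inv-r = proof }
    where
    open import Relation.Binary.Reasoning.Setoid setoid
    a = Unit.val u ; a' = Unit.inv u ; b = Unit.val v ; b' = Unit.inv v
    proof : (a * b) * (a' * b') ≈ 1#
    proof = begin
      (a * b) * (a' * b')   ≈⟨ *-assoc a b (a' * b') ⟩
      a * (b * (a' * b'))   ≈⟨ *-congˡ (sym (*-assoc b a' b')) ⟩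
      a * ((b * a') * b')   ≈⟨ *-congˡ (*-congʳ (*-comm b a')) ⟩
      a * ((a' * b) * b')   ≈⟨ *-congˡ (*-assoc a' b b') ⟩
      a * (a' * (b * b'))   ≈⟨ sym (*-assoc a a' (b * b')) ⟩
      (a * a') * (b * b')   ≈⟨ *-cong (Unit.inv-r u) (Unit.inv-r v) ⟩
      1# * 1#               ≈⟨ *-identityˡ 1# ⟩
      1# ∎

  pow : Carrier → ℕ → Carrier
  pow a zero    = 1#
  pow a (suc k) = a * pow a k

  negPow : Unit → ℕ → Carrier
  negPow u k = pow (Unit.inv u) k

  sumL : List Carrier → Carrier
  sumL []       = 0#
  sumL (a ∷ as) = a + sumL as

  monomial : ∀ {n} → (Fin n → Carrier) → Subset n → Carrier
  monomial {zero}  z []            = 1#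
  monomial {suc n} z (inside ∷ A)  = z Data.Fin.zero * monomial (λ i → z (Data.Fin.suc i)) A
  monomial {suc n} z (outside ∷ A) = monomial (λ i → z (Data.Fin.suc i)) A

  sumCentral : ∀ {n} → RankedComplex n → (Subset n → Carrier) → Carrier
  sumCentral {n} D f =
    sumL (map (λ A → if does (A ⊆? RankedComplex.ground D)
                     then (if RankedComplex.central D A then f A else 0#)
                     else 0#)
              (subsets n))

  Z : ∀ {n} → RankedComplex n → Unit → (Fin n → Carrier) → Carrier
  Z D λu z = sumCentral D (λ A → negPow λu (RankedComplex.rank D A) * monomial z A)

-- Expanding Z(𝒞; λξ, xy) and the right-hand side as sums over subsets, both
-- become sums of one weight w(B, U) = [B, U ∈ 𝒞] ξ^{-r(U)} λ^{-r(B)} (−x)^B y^U: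
-- the left-hand side is Σ_U (−1)^{|U|} w(U, U), and the right-hand side, after
-- writing U = Y ∪ T for the summation variable Y of the contraction, is
-- Σ_{B ⊆ T ⊆ U} (−1)^{|T|} w(B, U).  The two agree because
-- Σ_{B ⊆ T ⊆ U} (−1)^{|T|} = (−1)^{|U|} [B = U].  The semimatroid axioms enter
-- only through down-closure (T ∈ 𝒞 when Y ∪ T ∈ 𝒞) and monotonicity of the rank
-- (so that the truncated difference r(Y ∪ T) ∸ r(T) is the true one).

module Submission where

open import Defs
open import Level using (Level)
open import Data.Nat using (ℕ; zero; suc)
import Data.Nat as ℕ
open import Data.Nat.Properties using (m+[n∸m]≡n)
open import Data.Fin using (Fin)
open import Data.Product using (_×_; _,_)
open import Data.Bool using (Bool; true; false; if_then_else_)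
open import Data.List using (List; []; _∷_; map; _++_)
open import Data.List.Properties using (map-++; map-∘)
open import Data.Vec using ([]; _∷_; here)
open import Data.Fin.Subset using (Subset; inside; outside; _⊆_; _∪_; _─_; ⊤)
open import Data.Fin.Subset.Properties using (_⊆?_; ⊆⊤; q⊆p∪q; drop-∷-⊆)
open import Relation.Nullary using (does; yes; no)
open import Relation.Nullary.Decidable using (dec-true)
import Relation.Binary.PropositionalEquality as ≡
open import Algebra.Bundles using (CommutativeRing)

module _ {c ℓ : Level} (R : CommutativeRing c ℓ) where
  open CommutativeRing R
  open Eval R
  open import Algebra.Properties.Ring ring using (-1*x≈-x; -‿involutive)
  open import Algebra.Properties.CommutativeSemigroup *-commutativeSemigroup
    using (x∙yz≈y∙xz; xy∙z≈y∙xz) renaming (interchange to *-interchange)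
  open import Algebra.Properties.CommutativeSemigroup +-commutativeSemigroup
    using () renaming (interchange to +-interchange)
  open import Algebra.Properties.CommutativeSemiring.Exp commutativeSemiring
    using (_^_; ^-homo-*; ^-distrib-*; ^-congˡ)
  open import Algebra.Solver.CommutativeMonoid *-commutativeMonoid
    using (solve; _⊜_; _⊕_)
  open import Relation.Binary.Reasoning.Setoid setoid

  x+-1*x≈0 : ∀ a → a + - 1# * a ≈ 0#
  x+-1*x≈0 a = trans (+-congˡ (-1*x≈-x a)) (-‿inverseʳ a)

  when : Bool → Carrier → Carrier
  when b a = if b then a else 0#

  when-true : ∀ {b} a → b ≡.≡ true → when b a ≈ a
  when-true a ≡.refl = refl

  when-cong : ∀ b {a a′} → a ≈ a′ → when b a ≈ when b a′
  when-cong true  eq = eq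
  when-cong false eq = refl

  when-zero : ∀ b → when b 0# ≈ 0#
  when-zero true  = refl
  when-zero false = refl

  when-*ˡ : ∀ b a a′ → a * when b a′ ≈ when b (a * a′)
  when-*ˡ true  a a′ = refl
  when-*ˡ false a a′ = zeroʳ a

  module _ {A : Set} where
    sumL-cong : ∀ (xs : List A) {f g : A → Carrier} → (∀ a → f a ≈ g a) →
                sumL (map f xs) ≈ sumL (map g xs)
    sumL-cong []       eq = refl
    sumL-cong (x ∷ xs) eq = +-cong (eq x) (sumL-cong xs eq)

    sumL-+ : ∀ (xs : List A) (f g : A → Carrier) →
             sumL (map (λ a → f a + g a) xs) ≈ sumL (map f xs) + sumL (map g xs)
    sumL-+ []       f g = sym (+-identityˡ 0#)
    sumL-+ (x ∷ xs) f g = trans (+-congˡ (sumL-+ xs f g)) (+-interchange _ _ _ _)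

    sumL-*ˡ : ∀ (xs : List A) a (f : A → Carrier) →
              a * sumL (map f xs) ≈ sumL (map (λ x → a * f x) xs)
    sumL-*ˡ []       a f = zeroʳ a
    sumL-*ˡ (x ∷ xs) a f = trans (distribˡ a _ _) (+-congˡ (sumL-*ˡ xs a f))

  sumL-++ : ∀ xs ys → sumL (xs ++ ys) ≈ sumL xs + sumL ys
  sumL-++ []       ys = sym (+-identityˡ _)
  sumL-++ (x ∷ xs) ys = trans (+-congˡ (sumL-++ xs ys)) (sym (+-assoc _ _ _))

  ∑ : (n : ℕ) → (Subset n → Carrier) → Carrier
  ∑ n f = sumL (map f (subsets n))

  ∑-cong : ∀ n {f g : Subset n → Carrier} → (∀ A → f A ≈ g A) → ∑ n f ≈ ∑ n g
  ∑-cong n = sumL-cong (subsets n)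

  ∑-zero : ∀ n {f : Subset n → Carrier} → (∀ A → f A ≈ 0#) → ∑ n f ≈ 0#
  ∑-zero n {f} eq = trans (∑-cong n eq) (sumL-zero (subsets n))
    where
    sumL-zero : (xs : List (Subset n)) → sumL (map (λ _ → 0#) xs) ≈ 0#
    sumL-zero []       = refl
    sumL-zero (_ ∷ xs) = trans (+-identityˡ _) (sumL-zero xs)

  ∑-+ : ∀ n (f g : Subset n → Carrier) → ∑ n (λ A → f A + g A) ≈ ∑ n f + ∑ n g
  ∑-+ n = sumL-+ (subsets n)

  ∑-*ˡ : ∀ n a (f : Subset n → Carrier) → a * ∑ n f ≈ ∑ n (λ A → a * f A)
  ∑-*ˡ n = sumL-*ˡ (subsets n)

  ∑-product : ∀ n (f g : Subset n → Carrier) →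
              ∑ n f * ∑ n g ≈ ∑ n (λ A → ∑ n (λ B → f A * g B))
  ∑-product n f g = begin
    ∑ n f * ∑ n g                     ≈⟨ *-comm _ _ ⟩
    ∑ n g * ∑ n f                     ≈⟨ ∑-*ˡ n _ f ⟩
    ∑ n (λ A → ∑ n g * f A)           ≈⟨ ∑-cong n (λ A → trans (*-comm _ _) (∑-*ˡ n (f A) g)) ⟩
    ∑ n (λ A → ∑ n (λ B → f A * g B)) ∎

  ∑-when : ∀ n b (f : Subset n → Carrier) → when b (∑ n f) ≈ ∑ n (λ A → when b (f A))
  ∑-when n true  f = refl
  ∑-when n false f = sym (∑-zero n (λ _ → refl))

  ∑-suc : ∀ n (f : Subset (suc n) → Carrier) →
          ∑ (suc n) f ≈ ∑ n (λ A → f (outside ∷ A)) + ∑ n (λ A → f (inside ∷ A))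
  ∑-suc n f = begin
    sumL (map f (map (outside ∷_) As ++ map (inside ∷_) As))
      ≈⟨ reflexive (≡.cong sumL (map-++ f (map (outside ∷_) As) _)) ⟩
    sumL (map f (map (outside ∷_) As) ++ map f (map (inside ∷_) As))
      ≈⟨ sumL-++ (map f (map (outside ∷_) As)) _ ⟩
    sumL (map f (map (outside ∷_) As)) + sumL (map f (map (inside ∷_) As))
      ≈⟨ reflexive (≡.cong₂ _+_ (≡.cong sumL (≡.sym (map-∘ As)))
                                (≡.cong sumL (≡.sym (map-∘ As)))) ⟩
    ∑ n (λ A → f (outside ∷ A)) + ∑ n (λ A → f (inside ∷ A)) ∎
    where As = subsets n

  pow≡^ : ∀ a k → pow a k ≡.≡ a ^ k
  pow≡^ a zero    = ≡.refl
  pow≡^ a (suc k) = ≡.cong (a *_) (pow≡^ a k)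

  pow-+ : ∀ a m k → pow a m * pow a k ≈ pow a (m ℕ.+ k)
  pow-+ a m k rewrite pow≡^ a m | pow≡^ a k | pow≡^ a (m ℕ.+ k) = sym (^-homo-* a m k)

  pow-* : ∀ a b k → pow (a * b) k ≈ pow a k * pow b k
  pow-* a b k rewrite pow≡^ (a * b) k | pow≡^ a k | pow≡^ b k = ^-distrib-* a b k

  pow-cong : ∀ {a b} k → a ≈ b → pow a k ≈ pow b k
  pow-cong {a} {b} k eq rewrite pow≡^ a k | pow≡^ b k = ^-congˡ k eq

  pow-1# : ∀ k → pow 1# k ≈ 1#
  pow-1# zero    = refl
  pow-1# (suc k) = trans (*-identityˡ _) (pow-1# k)

  sgn : ∀ {n} → Subset n → Carrier
  sgn = monomial (λ _ → - 1#)

  monomial-cong : ∀ {n} {z z′ : Fin n → Carrier} → (∀ e → z e ≈ z′ e) →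
                  ∀ A → monomial z A ≈ monomial z′ A
  monomial-cong {zero}  eq []            = refl
  monomial-cong {suc n} eq (inside ∷ A)  =
    *-cong (eq Data.Fin.zero) (monomial-cong (λ i → eq (Data.Fin.suc i)) A)
  monomial-cong {suc n} eq (outside ∷ A) = monomial-cong (λ i → eq (Data.Fin.suc i)) A

  monomial-* : ∀ {n} (x y : Fin n → Carrier) A →
               monomial (λ e → x e * y e) A ≈ monomial x A * monomial y A
  monomial-* {zero}  x y []            = sym (*-identityˡ 1#)
  monomial-* {suc n} x y (inside ∷ A)  =
    trans (*-congˡ (monomial-* (λ i → x (Data.Fin.suc i)) (λ i → y (Data.Fin.suc i)) A))
          (*-interchange _ _ _ _)
  monomial-* {suc n} x y (outside ∷ A) =
    monomial-* (λ i → x (Data.Fin.suc i)) (λ i → y (Data.Fin.suc i)) A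

  monomial-neg : ∀ {n} (z : Fin n → Carrier) A →
                 monomial (λ e → - z e) A ≈ sgn A * monomial z A
  monomial-neg z A = begin
    monomial (λ e → - z e) A             ≈⟨ monomial-cong (λ e → sym (-1*x≈-x (z e))) A ⟩
    monomial (λ e → - 1# * z e) A        ≈⟨ monomial-* (λ _ → - 1#) z A ⟩
    sgn A * monomial z A                 ∎

  sgn-square : ∀ {n} (A : Subset n) → sgn A * sgn A ≈ 1#
  sgn-square {zero}  []            = *-identityˡ 1#
  sgn-square {suc n} (inside ∷ A)  = begin
    (- 1# * sgn A) * (- 1# * sgn A)  ≈⟨ *-interchange _ _ _ _ ⟩
    (- 1# * - 1#) * (sgn A * sgn A)  ≈⟨ *-cong (trans (-1*x≈-x _) (-‿involutive 1#)) (sgn-square A) ⟩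
    1# * 1#                          ≈⟨ *-identityˡ 1# ⟩
    1#                               ∎
  sgn-square {suc n} (outside ∷ A) = sgn-square A

  monomial-∪ : ∀ {n} (z : Fin n → Carrier) (Y T : Subset n) → Y ⊆ ⊤ ─ T →
               monomial z T * monomial z Y ≈ monomial z (Y ∪ T)
  monomial-∪ {zero}  z []            []            _ = *-identityˡ 1#
  monomial-∪ {suc n} z (outside ∷ Y) (outside ∷ T) p =
    monomial-∪ (λ i → z (Data.Fin.suc i)) Y T (drop-∷-⊆ p)
  monomial-∪ {suc n} z (inside ∷ Y)  (outside ∷ T) p =
    trans (x∙yz≈y∙xz _ _ _) (*-congˡ (monomial-∪ (λ i → z (Data.Fin.suc i)) Y T (drop-∷-⊆ p)))
  monomial-∪ {suc n} z (outside ∷ Y) (inside ∷ T)  p =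
    trans (*-assoc _ _ _) (*-congˡ (monomial-∪ (λ i → z (Data.Fin.suc i)) Y T (drop-∷-⊆ p)))
  monomial-∪ {suc n} z (inside ∷ Y)  (inside ∷ T)  p with p here
  ... | ()

  -- Σ_{B ⊆ T ⊆ U} (−1)^{|T|} h(B, U), with U = Y ∪ T for Y ⊆ E − T.

  intervalTerm : ∀ {n} → (Subset n → Subset n → Carrier) →
                 Subset n → Subset n → Subset n → Carrier
  intervalTerm h T B Y =
    when (does (B ⊆? T)) (when (does (Y ⊆? (⊤ ─ T))) (sgn T * h B (Y ∪ T)))

  intervalSumOver : ∀ {n} → (Subset n → Subset n → Carrier) → Subset n → Carrier
  intervalSumOver {n} h T = ∑ n λ B → ∑ n λ Y → intervalTerm h T B Y

  intervalSum : ∀ n → (Subset n → Subset n → Carrier) → Carrier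
  intervalSum n h = ∑ n (intervalSumOver h)

  diagonalSum : ∀ n → (Subset n → Subset n → Carrier) → Carrier
  diagonalSum n h = ∑ n λ U → sgn U * h U U

  headed : ∀ {n} → Bool → Bool → (Subset (suc n) → Subset (suc n) → Carrier) →
           Subset n → Subset n → Carrier
  headed s t h B U = h (s ∷ B) (t ∷ U)

  scaled : ∀ {n} → Carrier → (Subset n → Subset n → Carrier) → Subset n → Subset n → Carrier
  scaled a h B U = a * h B U

  intervalSum-scaled : ∀ n a h → intervalSum n (scaled a h) ≈ a * intervalSum n h
  intervalSum-scaled n a h = sym (begin
    a * intervalSum n h
      ≈⟨ ∑-*ˡ n a _ ⟩
    ∑ n (λ T → a * intervalSumOver h T)
      ≈⟨ ∑-cong n (λ T → trans (∑-*ˡ n a _) (∑-cong n (λ B → ∑-*ˡ n a _))) ⟩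
    ∑ n (λ T → ∑ n λ B → ∑ n λ Y → a * intervalTerm h T B Y)
      ≈⟨ ∑-cong n (λ T → ∑-cong n (λ B → ∑-cong n (λ Y → term-scaled T B Y))) ⟩
    intervalSum n (scaled a h) ∎)
    where
    term-scaled : ∀ T B Y → a * intervalTerm h T B Y ≈ intervalTerm (scaled a h) T B Y
    term-scaled T B Y =
      trans (when-*ˡ (does (B ⊆? T)) a _) (when-cong (does (B ⊆? T))
        (trans (when-*ˡ (does (Y ⊆? (⊤ ─ T))) a _) (when-cong (does (Y ⊆? (⊤ ─ T)))
          (x∙yz≈y∙xz a (sgn T) _))))

  intervalSumOver-outside : ∀ {n} h T →
    intervalSumOver {suc n} h (outside ∷ T)
      ≈ intervalSumOver (headed outside outside h) T + intervalSumOver (headed outside inside h) T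
  intervalSumOver-outside {n} h T = begin
    intervalSumOver h (outside ∷ T)
      ≈⟨ ∑-suc n _ ⟩
    ∑ n (λ B → ∑ (suc n) (intervalTerm h (outside ∷ T) (outside ∷ B)))
      + ∑ n (λ B → ∑ (suc n) (intervalTerm h (outside ∷ T) (inside ∷ B)))
      ≈⟨ +-cong (∑-cong n (λ B → ∑-suc n _)) (∑-zero n (λ B → ∑-zero (suc n) (λ Y → refl))) ⟩
    ∑ n (λ B → ∑ n (intervalTerm (headed outside outside h) T B)
                 + ∑ n (intervalTerm (headed outside inside h) T B)) + 0#
      ≈⟨ trans (+-identityʳ _) (∑-+ n _ _) ⟩
    intervalSumOver (headed outside outside h) T + intervalSumOver (headed outside inside h) T ∎

  intervalSumOver-inside : ∀ {n} h T →
    intervalSumOver {suc n} h (inside ∷ T)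
      ≈ intervalSumOver (scaled (- 1#) (headed outside inside h)) T
        + intervalSumOver (scaled (- 1#) (headed inside inside h)) T
  intervalSumOver-inside {n} h T =
    trans (∑-suc n _) (+-cong (∑-cong n (fibre outside)) (∑-cong n (fibre inside)))
    where
    moved : ∀ s B Y → intervalTerm h (inside ∷ T) (s ∷ B) (outside ∷ Y)
                      ≈ intervalTerm (scaled (- 1#) (headed s inside h)) T B Y
    moved outside B Y = when-cong (does (B ⊆? T)) (when-cong _ (xy∙z≈y∙xz _ _ _))
    moved inside  B Y = when-cong (does (B ⊆? T)) (when-cong _ (xy∙z≈y∙xz _ _ _))

    vanishing : ∀ s B Y → intervalTerm h (inside ∷ T) (s ∷ B) (inside ∷ Y) ≈ 0#
    vanishing outside B Y = when-zero (does (B ⊆? T))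
    vanishing inside  B Y = when-zero (does (B ⊆? T))

    fibre : ∀ s B → ∑ (suc n) (intervalTerm h (inside ∷ T) (s ∷ B))
                    ≈ ∑ n (intervalTerm (scaled (- 1#) (headed s inside h)) T B)
    fibre s B =
      trans (∑-suc n _) (trans (+-cong (∑-cong n (moved s B)) (∑-zero n (vanishing s B)))
                               (+-identityʳ _))

  intervalSum-suc : ∀ n h →
    intervalSum (suc n) h
      ≈ (intervalSum n (headed outside outside h) + intervalSum n (headed outside inside h))
        + (intervalSum n (scaled (- 1#) (headed outside inside h))
           + intervalSum n (scaled (- 1#) (headed inside inside h)))
  intervalSum-suc n h =
    trans (∑-suc n _) (+-cong (trans (∑-cong n (intervalSumOver-outside h)) (∑-+ n _ _))
                              (trans (∑-cong n (intervalSumOver-inside h)) (∑-+ n _ _)))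

  diagonalSum-suc : ∀ n h →
    diagonalSum (suc n) h
      ≈ diagonalSum n (headed outside outside h) + - 1# * diagonalSum n (headed inside inside h)
  diagonalSum-suc n h =
    trans (∑-suc n _) (+-congˡ (trans (∑-cong n (λ U → *-assoc _ _ _)) (sym (∑-*ˡ n _ _))))

  -- Splitting off the first element, the terms in which it lies in T but not in B
  -- cancel those in which it lies in U but not in T.
  intervalSum≈diagonalSum : ∀ n h → intervalSum n h ≈ diagonalSum n h
  intervalSum≈diagonalSum zero    h = +-congʳ (trans (+-identityʳ _) (+-identityʳ _))
  intervalSum≈diagonalSum (suc n) h = begin
    intervalSum (suc n) h
      ≈⟨ intervalSum-suc n h ⟩
    (I₀₀ + I₀₁) + (intervalSum n (scaled (- 1#) h₀₁) + intervalSum n (scaled (- 1#) h₁₁))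
      ≈⟨ +-congˡ (+-cong (intervalSum-scaled n _ h₀₁) (intervalSum-scaled n _ h₁₁)) ⟩
    (I₀₀ + I₀₁) + (- 1# * I₀₁ + - 1# * I₁₁)
      ≈⟨ trans (+-congˡ (+-comm _ _)) (+-interchange _ _ _ _) ⟩
    (I₀₀ + - 1# * I₁₁) + (I₀₁ + - 1# * I₀₁)
      ≈⟨ trans (+-congˡ (x+-1*x≈0 I₀₁)) (+-identityʳ _) ⟩
    I₀₀ + - 1# * I₁₁
      ≈⟨ +-cong (intervalSum≈diagonalSum n h₀₀) (*-congˡ (intervalSum≈diagonalSum n h₁₁)) ⟩
    diagonalSum n h₀₀ + - 1# * diagonalSum n h₁₁
      ≈⟨ diagonalSum-suc n h ⟨
    diagonalSum (suc n) h ∎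
    where
    h₀₀ = headed outside outside h
    h₀₁ = headed outside inside h
    h₁₁ = headed inside inside h
    I₀₀ = intervalSum n h₀₀
    I₀₁ = intervalSum n h₀₁
    I₁₁ = intervalSum n h₁₁

  negPow-∸ : ∀ u {m k} → m ℕ.≤ k → negPow u m * negPow u (k ℕ.∸ m) ≈ negPow u k
  negPow-∸ u {m} {k} m≤k =
    trans (pow-+ (Unit.inv u) m (k ℕ.∸ m)) (reflexive (≡.cong (pow (Unit.inv u)) (m+[n∸m]≡n m≤k)))

  sumCentral-toRC : ∀ {n} (M : Semimatroid n) (f : Subset n → Carrier) →
    sumCentral (toRC M) f ≈ ∑ n (λ A → when (Semimatroid.central M A) (f A))
  sumCentral-toRC {n} M f = ∑-cong n (λ A → when-true _ (dec-true (A ⊆? ⊤) ⊆⊤))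

  module _ {n : ℕ} (M : Semimatroid n) where
    open Semimatroid M renaming (central to C; rank to r)
    open IsSemimatroid isSemimatroid using (downClosed; sr2)

    module _ (λu ξu : Unit) (x y : Fin n → Carrier) where

      weight : Subset n → Subset n → Carrier
      weight B U = when (C U) (when (C B)
        (((negPow ξu (r U) * negPow λu (r B)) * monomial (λ e → - x e) B) * monomial y U))

      Z-term≈sgn*weight : ∀ U →
        when (C U) (negPow (λu ·U ξu) (r U) * monomial (λ e → x e * y e) U) ≈ sgn U * weight U U
      Z-term≈sgn*weight U with C U
      ... | false = sym (zeroʳ _)
      ... | true  = begin
        negPow (λu ·U ξu) (r U) * monomial (λ e → x e * y e) U
          ≈⟨ *-cong (pow-* (Unit.inv λu) (Unit.inv ξu) (r U)) (monomial-* x y U) ⟩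
        (pλ * pξ) * (mx * my)
          ≈⟨ *-identityˡ _ ⟨
        1# * ((pλ * pξ) * (mx * my))
          ≈⟨ *-congʳ (sgn-square U) ⟨
        (s * s) * ((pλ * pξ) * (mx * my))
          ≈⟨ solve 5 (λ s pλ pξ mx my → (s ⊕ s) ⊕ ((pλ ⊕ pξ) ⊕ (mx ⊕ my))
                                       ⊜ s ⊕ (((pξ ⊕ pλ) ⊕ (s ⊕ mx)) ⊕ my))
                     refl s pλ pξ mx my ⟩
        s * (((pξ * pλ) * (s * mx)) * my)
          ≈⟨ *-congˡ (*-congʳ (*-congˡ (monomial-neg x U))) ⟨
        s * (((pξ * pλ) * monomial (λ e → - x e) U) * my) ∎
        where
        s  = sgn U
        pλ = negPow λu (r U)
        pξ = negPow ξu (r U)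
        mx = monomial x U
        my = monomial y U

      convolution-term≈intervalTerm : ∀ T B Y →
        when (C T)
          (((negPow ξu (r T) * monomial (λ e → - y e) T)
            * when (does (B ⊆? T)) (when (C B) (negPow λu (r B) * monomial (λ e → - x e) B)))
            * when (does (Y ⊆? (⊤ ─ T)))
                (when (C (Y ∪ T)) (negPow ξu (r (Y ∪ T) ℕ.∸ r T) * monomial y Y)))
        ≈ intervalTerm weight T B Y
      convolution-term≈intervalTerm T B Y with B ⊆? T | Y ⊆? (⊤ ─ T)
      ... | no _  | _    = trans (when-cong (C T) (trans (*-congʳ (zeroʳ _)) (zeroˡ _))) (when-zero (C T))
      ... | yes _ | no _ = trans (when-cong (C T) (zeroʳ _)) (when-zero (C T))
      ... | yes _ | yes Y⊆∁T with C (Y ∪ T) in Y∪T∈C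
      ...   | false = trans (when-cong (C T) (zeroʳ _)) (trans (when-zero (C T)) (sym (zeroʳ _)))
      ...   | true  rewrite downClosed Y∪T∈C (q⊆p∪q Y T) with C B
      ...     | false = trans (*-congʳ (zeroʳ _)) (trans (zeroˡ _) (sym (zeroʳ _)))
      ...     | true  = begin
        ((pT * monomial (λ e → - y e) T) * (pB * mx)) * (pΔ * monomial y Y)
          ≈⟨ *-congʳ (*-congʳ (*-congˡ (monomial-neg y T))) ⟩
        ((pT * (s * monomial y T)) * (pB * mx)) * (pΔ * monomial y Y)
          ≈⟨ solve 7 (λ pT s myT pB mx pΔ myY → ((pT ⊕ (s ⊕ myT)) ⊕ (pB ⊕ mx)) ⊕ (pΔ ⊕ myY)
                                              ⊜ s ⊕ ((((pT ⊕ pΔ) ⊕ pB) ⊕ mx) ⊕ (myT ⊕ myY)))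
                     refl pT s (monomial y T) pB mx pΔ (monomial y Y) ⟩
        s * ((((pT * pΔ) * pB) * mx) * (monomial y T * monomial y Y))
          ≈⟨ *-congˡ (*-cong (*-congʳ (*-congʳ (negPow-∸ ξu (sr2 T∈C Y∪T∈C (q⊆p∪q Y T)))))
                             (monomial-∪ y Y T Y⊆∁T)) ⟩
        s * (((negPow ξu (r (Y ∪ T)) * pB) * mx) * monomial y (Y ∪ T)) ∎
        where
        T∈C = downClosed Y∪T∈C (q⊆p∪q Y T)
        s  = sgn T
        pT = negPow ξu (r T)
        pB = negPow λu (r B)
        pΔ = negPow ξu (r (Y ∪ T) ℕ.∸ r T)
        mx = monomial (λ e → - x e) B

      Z-product≈diagonalSum :
        Z (toRC M) (λu ·U ξu) (λ e → x e * y e) ≈ diagonalSum n weight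
      Z-product≈diagonalSum = trans (sumCentral-toRC M _) (∑-cong n Z-term≈sgn*weight)

      convolution≈intervalSum :
        sumCentral (toRC M) (λ T →
          negPow ξu (r T) * monomial (λ e → - y e) T
            * Z (restrict M T) λu (λ e → - x e)
            * Z (contract M T) ξu y)
        ≈ intervalSum n weight
      convolution≈intervalSum = trans (sumCentral-toRC M _) (∑-cong n expand)
        where
        expand : ∀ T →
          when (C T) (negPow ξu (r T) * monomial (λ e → - y e) T
                        * Z (restrict M T) λu (λ e → - x e) * Z (contract M T) ξu y)
          ≈ intervalSumOver weight T
        expand T = begin
          when (C T) ((a * ∑ n f) * ∑ n g)
            ≈⟨ when-cong (C T) (trans (*-congʳ (∑-*ˡ n a f)) (∑-product n _ g)) ⟩
          when (C T) (∑ n λ B → ∑ n λ Y → (a * f B) * g Y)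
            ≈⟨ trans (∑-when n (C T) _) (∑-cong n (λ B → ∑-when n (C T) _)) ⟩
          ∑ n (λ B → ∑ n λ Y → when (C T) ((a * f B) * g Y))
            ≈⟨ ∑-cong n (λ B → ∑-cong n (convolution-term≈intervalTerm T B)) ⟩
          intervalSumOver weight T ∎
          where
          a = negPow ξu (r T) * monomial (λ e → - y e) T
          f g : Subset n → Carrier
          f B = when (does (B ⊆? T)) (when (C B) (negPow λu (r B) * monomial (λ e → - x e) B))
          g Y = when (does (Y ⊆? (⊤ ─ T)))
                  (when (C (Y ∪ T)) (negPow ξu (r (Y ∪ T) ℕ.∸ r T) * monomial y Y))

      Z-convolution :
        Z (toRC M) (λu ·U ξu) (λ e → x e * y e)
        ≈ sumCentral (toRC M) (λ T →
            negPow ξu (r T) * monomial (λ e → - y e) T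
              * Z (restrict M T) λu (λ e → - x e)
              * Z (contract M T) ξu y)
      Z-convolution = begin
        Z (toRC M) (λu ·U ξu) (λ e → x e * y e) ≈⟨ Z-product≈diagonalSum ⟩
        diagonalSum n weight                     ≈⟨ intervalSum≈diagonalSum n weight ⟨
        intervalSum n weight                     ≈⟨ convolution≈intervalSum ⟨
        sumCentral (toRC M) _                    ∎

    Z-convolution-at-1 : (λu : Unit) (y : Fin n → Carrier) →
      Z (toRC M) λu y
        ≈ sumCentral (toRC M) (λ T →
            monomial (λ e → - y e) T
              * Z (restrict M T) λu (λ e → - 1#)
              * Z (contract M T) oneU y)
    Z-convolution-at-1 λu y = begin
      Z (toRC M) λu y
        ≈⟨ ∑-cong n (λ A → when-cong (does (A ⊆? ⊤)) (when-cong (C A)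
             (*-cong (pow-cong (r A) (sym (*-identityʳ _))) (monomial-cong (λ e → sym (*-identityˡ _)) A)))) ⟩
      Z (toRC M) (λu ·U oneU) (λ e → 1# * y e)
        ≈⟨ Z-convolution λu oneU (λ _ → 1#) y ⟩
      sumCentral (toRC M) _
        ≈⟨ ∑-cong n (λ T → when-cong (does (T ⊆? ⊤)) (when-cong (C T)
             (*-congʳ (*-congʳ (trans (*-congʳ (pow-1# (r T))) (*-identityˡ _)))))) ⟩
      sumCentral (toRC M) _ ∎

theorem2p6 : {c ℓ : Level} (R : CommutativeRing c ℓ) (n : ℕ) (M : Semimatroid n) →
    let open CommutativeRing R
        open Eval R
        r = Semimatroid.rank M
    in
    ((λu ξu : Unit) (x y : Fin n → Carrier) →
      Z (toRC M) (λu ·U ξu) (λ e → x e * y e)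
        ≈ sumCentral (toRC M) (λ T →
            negPow ξu (r T) * monomial (λ e → - y e) T
              * Z (restrict M T) λu (λ e → - x e)
              * Z (contract M T) ξu y))
    ×
    ((λu : Unit) (y : Fin n → Carrier) →
      Z (toRC M) λu y
        ≈ sumCentral (toRC M) (λ T →
            monomial (λ e → - y e) T
              * Z (restrict M T) λu (λ e → - 1#)
              * Z (contract M T) oneU y))
theorem2p6 R n M = Z-convolution R M , Z-convolution-at-1 R M
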